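{- Let $G=(V,E)$ be a connected non-trivial graph. For any $x,y\in V$ and any integer $t\ge 1$, $$d_{S(G,t)}(x^t,y^t)=(2^t-1)\,d_G(x,y).$$
   Context: For a graph $G=(V,E)$ and a positive integer $t$, $V^t$ denotes the set of words of length $t$ over the alphabet $V$; concatenation of words is written by juxtaposition, and $x^k$ denotes the word consisting of $k$ copies of the letter $x$. The generalized Sierpiński graph $S(G,t)$ has vertex set $V^t$ and edge set $\{\{w u_i u_j^{d-1}, w u_j u_i^{d-1}\} : \{u_i,u_j\}\in E,\ d\in\{1,\dots,t\},\ w\in V^{t-d}\}$. $d_H$ denotes the shortest-path distance in a graph $H$. -}

module Defs where

open import Data.Nat using (ℕ; zero; suc; _+_; _≤_)
open import Data.Fin using (Fin)
open import Data.List using (List; _∷_; _++_; replicate)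
open import Data.Vec using (Vec; toList)
open import Data.Product using (Σ; _×_; ∃-syntax)
open import Relation.Binary.PropositionalEquality using (_≡_; _≢_)
open import Relation.Nullary using (¬_)

record Graph : Set₁ where
  field
    n      : ℕ
    Adj    : Fin n → Fin n → Set
    sym    : ∀ {u v} → Adj u v → Adj v u
    irrefl : ∀ {u} → ¬ Adj u u
open Graph public

data Walk {A : Set} (R : A → A → Set) : A → A → ℕ → Set where
  here  : ∀ {u} → Walk R u u zero
  step  : ∀ {u v w k} → R u v → Walk R v w k → Walk R u w (suc k)

Dist : {A : Set} (R : A → A → Set) → A → A → ℕ → Set
Dist R u v k = Walk R u v k × (∀ m → Walk R u v m → k ≤ m)

Connected : Graph → Set
Connected G = ∀ (x y : Fin (n G)) → ∃[ k ] Walk (Adj G) x y k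

NonTrivial : Graph → Set
NonTrivial G = 2 ≤ n G

-- Adjacency of the generalized Sierpiński graph S(G,t) on words V^t (Vec (Fin n) t):
-- u ~ v iff u = w a b^(d-1), v = w b a^(d-1) for some edge {a,b} of G,
-- word w and d ≥ 1 (here d - 1 = e).
SAdj : (G : Graph) (t : ℕ) → Vec (Fin (n G)) t → Vec (Fin (n G)) t → Set
SAdj G t u v =
  Σ (List (Fin (n G))) λ w → Σ (Fin (n G)) λ a → Σ (Fin (n G)) λ b → Σ ℕ λ e →
    Adj G a b × (toList u ≡ w ++ (a ∷ replicate e b)) × (toList v ≡ w ++ (b ∷ replicate e a))

module Submission where

-- Write f = 2^t - 1, so that 2^(t+1) - 1 = 2f + 1.  Both inequalities are
-- proved by induction on t, passing from S(G,t) to S(G,t+1) whose vertices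
-- c ∷ u lie in copies c of S(G,t) joined by the edges  a b^t ~ b a^t  (a ~ b).
--
-- Upper bound: along a G-walk x = c₀, c₁, …, c_k = y travel inside copy cᵢ
-- from cᵢ₋₁^t to cᵢ₊₁^t (cost ≤ 2f by induction) and cross to copy cᵢ₊₁.
--
-- Lower bound: we prove the walk-level statement "every S(G,t)-walk from
-- p^t to q^t of length ℓ yields a G-walk p → q of length k with f·k ≤ ℓ".
-- An S(G,t+1)-walk from x^(t+1) visits copies c₀ = x, …, c_r = y and inside
-- copy cᵢ runs from cᵢ₋₁^t to cᵢ₊₁^t, which by induction pays f times a
-- G-walk cᵢ₋₁ → cᵢ₊₁.  Chaining the even and the odd segments gives two
-- G-walks x → y, and c₀ … c_r a third one of length r; hence the length is
-- at least f·d + f·d + d.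

open import Defs
open import Data.Nat using (ℕ; zero; suc; _+_; _*_; _∸_; _^_; _≤_; z≤n; s≤s)
open import Data.Nat.Properties
open import Data.Nat.Tactic.RingSolver using (solve-∀)
open import Data.Fin using (Fin)
import Data.List as List
open import Data.List.Properties using (∷-injective)
open import Data.Vec using (Vec; []; _∷_; replicate; toList)
open import Data.Vec.Properties using (toList-replicate)
open import Data.Product using (Σ; _×_; _,_)
open import Data.Sum using (_⊎_; inj₁; inj₂)
open import Relation.Binary.PropositionalEquality
  using (_≡_; refl; cong; subst; trans) renaming (sym to ≡-sym)
open import Relation.Nullary using (yes; no)

module _ {A : Set} {R : A → A → Set} where

  _++ᵂ_ : ∀ {u v w a b} → Walk R u v a → Walk R v w b → Walk R u w (a + b)
  here     ++ᵂ q = q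
  step r p ++ᵂ q = step r (p ++ᵂ q)

  snoc : ∀ {u v w a} → Walk R u v a → R v w → Walk R u w (suc a)
  snoc here       r′ = step r′ here
  snoc (step r p) r′ = step r (snoc p r′)

  shorter : ∀ {u v a b} → Walk R u v a → Walk R u v b →
            Σ ℕ λ k → Walk R u v k × k ≤ a × k ≤ b
  shorter {a = a} {b} p q with a ≤? b
  ... | yes a≤b = a , p , ≤-refl , a≤b
  ... | no  a≰b = b , q , ≰⇒≥ a≰b , ≤-refl

record ScaledWalk {A : Set} (R : A → A → Set) (f : ℕ) (u v : A) (ℓ : ℕ) : Set where
  constructor scaled
  field
    {length} : ℕ
    walk     : Walk R u v length
    paid     : f * length ≤ ℓ

relax : ∀ {A : Set} {R : A → A → Set} {f u v ℓ ℓ′} →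
        ℓ ≤ ℓ′ → ScaledWalk R f u v ℓ → ScaledWalk R f u v ℓ′
relax ℓ≤ℓ′ (scaled w paid) = scaled w (≤-trans paid ℓ≤ℓ′)

mersenne-suc : ∀ t → 2 ^ suc t ∸ 1 ≡ suc (2 ^ t ∸ 1 + (2 ^ t ∸ 1))
mersenne-suc t with 2 ^ t | m^n>0 2 t
... | suc g | _ = cong (_∸ 1) (double g)
  where
  double : ∀ g → 2 * suc g ≡ suc (suc (g + g))
  double = solve-∀

module _ (G : Graph) where

  private
    V = Fin (n G)
    W = Walk (Adj G)
    S : (t : ℕ) → Vec V t → Vec V t → ℕ → Set
    S t = Walk (SAdj G t)

  constant-word : ∀ {t} (u : Vec V t) e (b : V) →
                  toList u ≡ List.replicate e b → u ≡ replicate t b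
  constant-word []      e       b eq = refl
  constant-word (_ ∷ u) zero    b ()
  constant-word (_ ∷ u) (suc e) b eq with ∷-injective eq
  ... | refl , eq′ = cong (b ∷_) (constant-word u e b eq′)

  liftEdge : ∀ {t} (c : V) {u v} → SAdj G t u v → SAdj G (suc t) (c ∷ u) (c ∷ v)
  liftEdge c (w , a , b , e , a~b , eu , ev) =
    c List.∷ w , a , b , e , a~b , cong (c List.∷_) eu , cong (c List.∷_) ev

  liftWalk : ∀ {t} (c : V) {u v m} → S t u v m → S (suc t) (c ∷ u) (c ∷ v) m
  liftWalk c here       = here
  liftWalk c (step e w) = step (liftEdge c e) (liftWalk c w)

  crossing : ∀ t {a b : V} → Adj G a b →
             SAdj G (suc t) (a ∷ replicate t b) (b ∷ replicate t a)
  crossing t {a} {b} a~b =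
    List.[] , a , b , t , a~b ,
    cong (a List.∷_) (toList-replicate t b) , cong (b List.∷_) (toList-replicate t a)

  edgeCases : ∀ {t} (c : V) (u : Vec V t) (v : Vec V (suc t)) →
    SAdj G (suc t) (c ∷ u) v →
    (Σ (Vec V t) λ u′ → v ≡ c ∷ u′ × SAdj G t u u′) ⊎
    (Σ V λ b → Adj G c b × u ≡ replicate t b × v ≡ b ∷ replicate t c)
  edgeCases c u (_ ∷ v) (List.[] , a , b , e , a~b , eu , ev)
    with ∷-injective eu | ∷-injective ev
  ... | refl , eu′ | refl , ev′ =
    inj₂ (b , a~b , constant-word u e b eu′ , cong (b ∷_) (constant-word v e c ev′))
  edgeCases c u (_ ∷ v) (_ List.∷ w , a , b , e , a~b , eu , ev)
    with ∷-injective eu | ∷-injective ev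
  ... | refl , eu′ | refl , ev′ = inj₁ (v , refl , (w , a , b , e , a~b , eu′ , ev′))

  Realizes : ℕ → Set
  Realizes t = ∀ (p q : V) j → W p q j →
               S t (replicate t p) (replicate t q) ((2 ^ t ∸ 1) * j)

  module Upper (t : ℕ) (realize : Realizes t) where

    private f = 2 ^ t ∸ 1

    route-length : ∀ j k → f * suc j + suc (f * 1 + suc (f + f) * k)
                         ≡ f * j + suc (f + f) * suc k
    route-length = identity f
      where
      identity : ∀ f j k → f * suc j + suc (f * 1 + suc (f + f) * k)
                         ≡ f * j + suc (f + f) * suc k
      identity = solve-∀

    -- Standing in copy c at c p^t, where p reaches c in j ≤ 1 steps, follow
    -- a G-walk c → y of length k: cost f·j + (2f+1)·k.
    route : ∀ {p c y : V} {j k} → W p c j → W c y k →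
            S (suc t) (c ∷ replicate t p) (replicate (suc t) y) (f * j + suc (f + f) * k)
    route {p} {c} {j = j} p→c here =
      subst (S _ _ _) (≡-sym (trans (cong (f * j +_) (*-zeroʳ (suc (f + f))))
                                    (+-identityʳ (f * j))))
            (liftWalk c (realize p c j p→c))
    route {p} {c} {j = j} {k = suc k} p→c (step {v = b} c~b b→y) =
      subst (S _ _ _) (route-length j k)
            (liftWalk c (realize p b (suc j) (snoc p→c c~b))
             ++ᵂ step (crossing t c~b) (route (step c~b here) b→y))

  realizes : ∀ t → Realizes t
  realizes zero    p q j p→q = here
  realizes (suc t) p q j p→q =
    subst (S _ _ _) cost (Upper.route t (realizes t) here p→q)
    where
    f = 2 ^ t ∸ 1
    cost : f * 0 + suc (f + f) * j ≡ (2 ^ suc t ∸ 1) * j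
    cost = trans (cong (_+ suc (f + f) * j) (*-zeroʳ f))
                 (cong (_* j) (≡-sym (mersenne-suc t)))

  Shrinks : ℕ → Set
  Shrinks t = ∀ (p q : V) ℓ → S t (replicate t p) (replicate t q) ℓ →
              ScaledWalk (Adj G) (2 ^ t ∸ 1) p q ℓ

  module Lower (t : ℕ) (shrink : Shrinks t) (x : V) where

    private f = 2 ^ t ∸ 1

    -- The state after s steps of an S(G,t+1)-walk from x^(t+1), now at c ∷ u.
    -- Copy c was entered at c entry^t (entry = c = x before the first
    -- crossing) and `inside` is the walk since then.  `toEntry` and `toCopy`
    -- are the two G-walks chaining the segments of alternate copies, and
    -- `copies` runs through the copies visited.
    record Progress (c : V) (u : Vec V t) (s : ℕ) : Set where
      field
        entry   : V
        {ℓ A B P} : ℕ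
        inside  : S t (replicate t entry) u ℓ
        toEntry : W x entry A
        toCopy  : W x c B
        copies  : W x c P
        budget  : P + f * (A + B) + ℓ ≤ s

    start : Progress x (replicate t x) 0
    start = record
      { entry = x ; inside = here ; toEntry = here ; toCopy = here ; copies = here
      ; budget = ≤-reflexive (trans (+-identityʳ (f * 0)) (*-zeroʳ f)) }

    moveInside : ∀ {c u u′ s} → Progress c u s → SAdj G t u u′ → Progress c u′ (suc s)
    moveInside {s = s} π e = record
      { entry = entry ; inside = snoc inside e
      ; toEntry = toEntry ; toCopy = toCopy ; copies = copies
      ; budget = subst (_≤ suc s) (≡-sym (+-suc (P + f * (A + B)) ℓ)) (s≤s budget) }
      where open Progress π

    -- After a crossing the old segment ℓ ≥ f·k is replaced by the G-walk of
    -- length k it pays for, and the crossing edge pays for one more copy.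
    crossing-budget : ∀ {P A B ℓ k s} → P + f * (A + B) + ℓ ≤ s → f * k ≤ ℓ →
                      suc P + f * (B + (A + k)) + 0 ≤ suc s
    crossing-budget {P} {A} {B} {ℓ} {k} {s} spent fk≤ℓ = begin
      suc P + f * (B + (A + k)) + 0  ≡⟨ regroup f P A B k ⟩
      suc (P + f * (A + B) + f * k)  ≤⟨ s≤s (+-monoʳ-≤ (P + f * (A + B)) fk≤ℓ) ⟩
      suc (P + f * (A + B) + ℓ)      ≤⟨ s≤s spent ⟩
      suc s                          ∎
      where
      open ≤-Reasoning
      regroup : ∀ f P A B k → suc P + f * (B + (A + k)) + 0
                            ≡ suc (P + f * (A + B) + f * k)
      regroup = solve-∀

    -- Crossing from copy c to copy b: the segment inside c pays for a G-walk
    -- entry → b, which extends the alternate chain ending at entry.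
    crossEdge : ∀ {c b s} → Progress c (replicate t b) s → Adj G c b →
                Progress b (replicate t c) (suc s)
    crossEdge {c} {b} π c~b =
      let open Progress π
          (scaled entry→b paid) = shrink entry b ℓ inside
      in record
        { entry = c ; inside = here
        ; toEntry = toCopy ; toCopy = toEntry ++ᵂ entry→b ; copies = snoc copies c~b
        ; budget = crossing-budget {P} {A} {B} budget paid }

    finish-budget : ∀ {m P A B ℓ k s} → m ≤ P → m ≤ A + k → m ≤ B →
                    f * k ≤ ℓ → P + f * (A + B) + ℓ ≤ s → suc (f + f) * m ≤ s
    finish-budget {m} {P} {A} {B} {ℓ} {k} {s} m≤P m≤A+k m≤B fk≤ℓ spent = begin
      suc (f + f) * m              ≡⟨ expand f m ⟩
      m + (f * m + f * m)          ≤⟨ +-mono-≤ m≤P (+-mono-≤ (*-monoʳ-≤ f m≤A+k)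
                                                           (*-monoʳ-≤ f m≤B)) ⟩
      P + (f * (A + k) + f * B)    ≡⟨ regroup f P A B k ⟩
      P + f * (A + B) + f * k      ≤⟨ +-monoʳ-≤ (P + f * (A + B)) fk≤ℓ ⟩
      P + f * (A + B) + ℓ          ≤⟨ spent ⟩
      s                            ∎
      where
      open ≤-Reasoning
      expand : ∀ f m → suc (f + f) * m ≡ m + (f * m + f * m)
      expand = solve-∀
      regroup : ∀ f P A B k → P + (f * (A + k) + f * B) ≡ P + f * (A + B) + f * k
      regroup = solve-∀

    -- Arrived in copy y at y^(t+1): the last segment pays for entry → y, and
    -- the shortest of the three resulting G-walks x → y is paid (2f+1) times.
    finish : ∀ {y s} → Progress y (replicate t y) s →
             ScaledWalk (Adj G) (suc (f + f)) x y s
    finish {y} π =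
      let open Progress π
          (scaled entry→y paid) = shrink entry y ℓ inside
          (_ , w₁ , k₁≤P , k₁≤B) = shorter copies toCopy
          (k , w , k≤k₁ , k≤A+k) = shorter w₁ (toEntry ++ᵂ entry→y)
      in scaled w (finish-budget (≤-trans k≤k₁ k₁≤P) k≤A+k (≤-trans k≤k₁ k₁≤B) paid budget)

    follow : ∀ {c u y s m} → Progress c u s →
             S (suc t) (c ∷ u) (replicate (suc t) y) m →
             ScaledWalk (Adj G) (suc (f + f)) x y (s + m)
    follow {s = s} π here = relax (m≤m+n s 0) (finish π)
    follow {c} {u} {s = s} π (step {v = v} {k = m} e rest) with edgeCases c u v e
    ... | inj₁ (_ , refl , e′) =
      relax (≤-reflexive (≡-sym (+-suc s m))) (follow (moveInside π e′) rest)
    ... | inj₂ (_ , c~b , refl , refl) =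
      relax (≤-reflexive (≡-sym (+-suc s m))) (follow (crossEdge π c~b) rest)

  shrinks : Connected G → ∀ t → Shrinks t
  shrinks connected zero    p q ℓ _ = let (_ , p→q) = connected p q in scaled p→q z≤n
  shrinks connected (suc t) p q ℓ walk =
    subst (λ rate → ScaledWalk (Adj G) rate p q ℓ) (≡-sym (mersenne-suc t))
          (follow start walk)
    where open Lower t (shrinks connected t) p

-- The distance is realized by `realizes` and bounded below via `shrinks` and
-- the minimality of d.
theorem4 : (G : Graph) → Connected G → NonTrivial G →
    ∀ (x y : Fin (n G)) (t : ℕ) → 1 ≤ t → ∀ (d : ℕ) → Dist (Adj G) x y d →
    Dist (SAdj G t) (replicate t x) (replicate t y) ((2 ^ t ∸ 1) * d)
theorem4 G connected _ x y t _ d (shortest , minimal) =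
  realizes G t x y d shortest ,
  λ m walk → let (scaled x→y paid) = shrinks G connected t x y m walk
             in ≤-trans (*-monoʳ-≤ (2 ^ t ∸ 1) (minimal _ x→y)) paid
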